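{- Let $V$ be a valuated matroid on $[n]$, $L=L(V)$, $M\in\mathcal M(V)$ and $x\in\operatorname{relint}(L_M)$. Then $\operatorname{relsupp}_x(y)$ is a flat of $M$ for every $y\in L$.
   Context: $\mathbb T=\mathbb R\cup\{\infty\}$, $\mathbb{TP}^{n-1}=(\mathbb T^n\setminus\{(\infty,\dots,\infty)\})/\mathbb R(1,\dots,1)$. A valuated matroid $V$ of rank $d$ on $[n]$ is a point of $\mathbb{TP}^{\binom nd-1}$ with coordinates $V_B$ indexed by $d$-subsets such that for every $(d-1)$-set $A$ and $(d+1)$-set $C$ the minimum of $V_{A\cup\{j\}}+V_{C\setminus\{j\}}$ over $j\in C\setminus A$ is attained at least twice; $\underline V$ has bases $\{B:V_B<\infty\}$. For $x\in\mathbb R^n$, $V^x$ is the matroid with bases the $B$ minimizing $V_B-\sum_{i\in B}x_i$; $\mathcal M(V)$ is the set of such $V^x$ all of whose loops are loops of $\underline V$. $L(V)=\{x\in\mathbb{TP}^{n-1}:$ for every $(d+1)$-set $C$, $\min_{j\in C}(x_j+V_{C\setminus\{j\}})$ attained at least twice$\}$. $\operatorname{relint}(L_M)=\{x\in\mathbb R^n/\mathbb R(1,\dots,1):V^x=M\}$. For $x$ with finite coordinates and $y\in\mathbb{TP}^{n-1}$, $\operatorname{relsupp}_x(y)$ is the set of $j$ at which $y_j-x_j$ does not attain its minimum over $j$. -}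

module Defs where

open import Level using (Level; suc; _⊔_)
open import Data.Nat as ℕ using (ℕ; zero) renaming (suc to sucℕ)
open import Data.Fin using (Fin) renaming (zero to fzero; suc to fsuc)
open import Data.Fin.Subset using (Subset; _∈_; _∉_; _∪_; _∩_; _─_; _-_; ⁅_⁆; ∣_∣)
open import Data.Vec using (_∷_; [])
open import Data.Bool using (true; false)
open import Data.Product using (Σ; ∃; _×_; _,_)
open import Data.Sum using (_⊎_)
open import Relation.Binary.PropositionalEquality using (_≡_; _≢_)
open import Relation.Nullary using (¬_)

-- Linearly ordered abelian groups (ℝ with + and ≤ is a model).
-- Equality is propositional.

record LinOrdAbGroup (c ℓ : Level) : Set (suc (c ⊔ ℓ)) where
  infixl 6 _+_
  infix 4 _≤_
  field
    Carrier   : Set c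
    _+_       : Carrier → Carrier → Carrier
    0#        : Carrier
    -_        : Carrier → Carrier
    _≤_       : Carrier → Carrier → Set ℓ
    +-assoc   : ∀ a b c → (a + b) + c ≡ a + (b + c)
    +-comm    : ∀ a b → a + b ≡ b + a
    +-identityˡ : ∀ a → 0# + a ≡ a
    -‿inverseˡ : ∀ a → (- a) + a ≡ 0#
    ≤-refl    : ∀ a → a ≤ a
    ≤-trans   : ∀ {a b c} → a ≤ b → b ≤ c → a ≤ c
    ≤-antisym : ∀ {a b} → a ≤ b → b ≤ a → a ≡ b
    ≤-total   : ∀ a b → (a ≤ b) ⊎ (b ≤ a)
    +-monoˡ-≤ : ∀ {a b} c → a ≤ b → a + c ≤ b + c

module Tropical {c ℓ : Level} (G : LinOrdAbGroup c ℓ) where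
  open LinOrdAbGroup G

  data T : Set c where
    fin : Carrier → T
    ∞   : T

  data IsFin : T → Set (c ⊔ ℓ) where
    isFin : ∀ a → IsFin (fin a)

  infix 4 _≤T_ _<T_
  data _≤T_ : T → T → Set (c ⊔ ℓ) where
    fin≤fin : ∀ {a b} → a ≤ b → fin a ≤T fin b
    _≤∞     : ∀ t → t ≤T ∞

  _<T_ : T → T → Set (c ⊔ ℓ)
  s <T t = (s ≤T t) × ¬ (t ≤T s)

  infixl 6 _+T_ _-ᵣ_
  _+T_ : T → T → T
  fin a +T fin b = fin (a + b)
  fin a +T ∞     = ∞
  ∞     +T t     = ∞

  _-ᵣ_ : T → Carrier → T
  t -ᵣ a = t +T fin (- a)

  sumOver : ∀ {n} → (Fin n → Carrier) → Subset n → Carrier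
  sumOver {zero}   x []          = 0#
  sumOver {sucℕ n} x (true ∷ B)  = x fzero + sumOver (λ i → x (fsuc i)) B
  sumOver {sucℕ n} x (false ∷ B) = sumOver (λ i → x (fsuc i)) B

  MinAttainedTwice : ∀ {n} → Subset n → (Fin n → T) → Set (c ⊔ ℓ)
  MinAttainedTwice S f =
    ∀ j → j ∈ S → (∀ k → k ∈ S → f j ≤T f k) →
    Σ _ λ k → (k ∈ S) × (k ≢ j) × (f k ≤T f j)

  -- a point of TP^{N-1}, given by a representative with some finite coordinate
  -- V : Subset n → T is a vector indexed by d-subsets (values on other subsets irrelevant)
  IsValuatedMatroid : (n d : ℕ) → (Subset n → T) → Set (c ⊔ ℓ)
  IsValuatedMatroid n d V =
    (Σ (Subset n) λ B → (∣ B ∣ ≡ d) × IsFin (V B)) ×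
    (∀ (A C : Subset n) → sucℕ ∣ A ∣ ≡ d → ∣ C ∣ ≡ sucℕ d →
       MinAttainedTwice (C ─ A) (λ j → V (A ∪ ⁅ j ⁆) +T V (C - j)))

  -- Matroids on [n] are given by their set of bases (a predicate on subsets)
  Matroid : ℕ → Set (suc (c ⊔ ℓ))
  Matroid n = Subset n → Set (c ⊔ ℓ)

  SameMatroid : ∀ {n} → Matroid n → Matroid n → Set (c ⊔ ℓ)
  SameMatroid M N = ∀ B → (M B → N B) × (N B → M B)

  UnderlyingBasis : ∀ {n} d → (Subset n → T) → Matroid n
  UnderlyingBasis d V B = (∣ B ∣ ≡ d) × IsFin (V B)

  -- bases of V^x: the d-subsets minimising V_B - Σ_{i∈B} x_i
  -- (with a finite value, since V is not identically ∞)
  InitialBasis : ∀ {n} d → (Subset n → T) → (Fin n → Carrier) → Matroid n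
  InitialBasis d V x B =
    (∣ B ∣ ≡ d) × IsFin (V B) ×
    (∀ B' → ∣ B' ∣ ≡ d → V B -ᵣ sumOver x B ≤T V B' -ᵣ sumOver x B')

  IsLoop : ∀ {n} → Matroid n → Fin n → Set (c ⊔ ℓ)
  IsLoop M e = ∀ B → M B → e ∉ B

  InMV : ∀ {n} d → (Subset n → T) → Matroid n → Set (c ⊔ ℓ)
  InMV d V M =
    Σ (Fin _ → Carrier) λ z →
      SameMatroid M (InitialBasis d V z) ×
      (∀ e → IsLoop M e → IsLoop (UnderlyingBasis d V) e)

  -- x ∈ relint(L_M)  (x a representative of a class in ℝ^n / ℝ·1)
  InRelint : ∀ {n} d → (Subset n → T) → Matroid n → (Fin n → Carrier) → Set (c ⊔ ℓ)
  InRelint d V M x = SameMatroid (InitialBasis d V x) M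

  InL : ∀ {n} d → (Subset n → T) → (Fin n → T) → Set (c ⊔ ℓ)
  InL {n} d V y =
    (Σ (Fin n) λ j → IsFin (y j)) ×
    (∀ C → ∣ C ∣ ≡ sucℕ d → MinAttainedTwice C (λ j → y j +T V (C - j)))

  InRelsupp : ∀ {n} → (Fin n → Carrier) → (Fin n → T) → Fin n → Set (c ⊔ ℓ)
  InRelsupp x y j = Σ _ λ k → (y k -ᵣ x k) <T (y j -ᵣ x j)

  IsRank : ∀ {n} → Matroid n → Subset n → ℕ → Set (c ⊔ ℓ)
  IsRank M S r =
    (Σ _ λ B → M B × (∣ B ∩ S ∣ ≡ r)) × (∀ B → M B → ∣ B ∩ S ∣ ℕ.≤ r)

  IsFlat : ∀ {n} → Matroid n → Subset n → Set (c ⊔ ℓ)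
  IsFlat M F = ∀ e → e ∉ F → ∀ r r' → IsRank M F r → IsRank M (F ∪ ⁅ e ⁆) r' → r ℕ.< r'

-- Write P j = y_j - x_j for the reduced coordinates of y and
-- w(S) = V_S - Σ_{i∈S} x_i for the x-weight of S; the bases of M = V^x are
-- the d-sets of minimal weight, and F = relsupp_x(y) is the set of j where
-- P j is not minimal.  Take e ∉ F, so P e is minimal, and a basis B of M
-- meeting F in rank(F) elements.  If e ∈ B, B itself witnesses that
-- F ∪ {e} has larger rank.  Otherwise apply the defining condition of L to
-- the circuit-sized set C = B ∪ {e}: the minimum of y_j + V_{C-j} over C is
-- attained at e, hence also at some k ≠ e, and comparing the two splittings
-- P j + w(C - j) shows that P k is minimal (so k ∉ F) and that C - k is a
-- basis of M.  This basis contains B ∩ F and e, so again rank grows.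
--
-- Only y ∈ L and x ∈ relint(L_M) are used.  The minimality of P e is only known up to
-- double negation (the order is not assumed decidable); since the
-- conclusion r < r' is decidable, this suffices.

module Submission where

open import Defs
open import Level using (Level)
open import Data.Nat using (ℕ)
open import Data.Fin using (Fin)
open import Data.Fin.Subset using (Subset; _∈_)
open import Data.Product using (_×_)

open import Algebra.Bundles using (AbelianGroup)
import Algebra.Properties.AbelianGroup as AbelianGroupProperties
import Algebra.Properties.CommutativeSemigroup as CommutativeSemigroupProperties
open import Data.Nat using (zero; suc; _<_; _<?_)
import Data.Nat.Properties as ℕₚ
open import Data.Fin using () renaming (zero to fzero; suc to fsuc)
open import Data.Fin.Subset using (_∉_; _∪_; _∩_; _-_; ⁅_⁆; ∣_∣; _⊆_)
open import Data.Fin.Subset.Properties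
  using (x∈p∪q⁻; x∈p∪q⁺; x∈p∩q⁻; x∈p∩q⁺; x∈⁅x⁆; x∈⁅y⁆⇒x≡y; x∈p∧x≢y⇒x∈p-y;
         ∪-identityʳ; p─⊥≡p; p─q⊆p; p⊆q⇒∣p∣≤∣q∣; ⊆-antisym; _∈?_)
open import Data.Vec using (_∷_; here; there)
open import Data.Bool using (true; false)
open import Data.Product using (Σ; _,_; proj₁; proj₂; map)
open import Data.Sum using (_⊎_; inj₁; inj₂) renaming (map to ⊎-map)
open import Function using (_∘_)
open import Relation.Nullary using (¬_; yes; no; contradiction)
open import Relation.Nullary.Negation using (¬¬-map)
open import Relation.Nullary.Decidable using (decidable-stable)
open import Relation.Binary.PropositionalEquality

∣p∪⁅x⁆∣≡1+∣p∣ : ∀ {n} (x : Fin n) (p : Subset n) → x ∉ p → ∣ p ∪ ⁅ x ⁆ ∣ ≡ suc ∣ p ∣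
∣p∪⁅x⁆∣≡1+∣p∣ fzero    (true ∷ p)  x∉p = contradiction here x∉p
∣p∪⁅x⁆∣≡1+∣p∣ fzero    (false ∷ p) _   = cong (suc ∘ ∣_∣) (∪-identityʳ p)
∣p∪⁅x⁆∣≡1+∣p∣ (fsuc x) (true ∷ p)  x∉p = cong suc (∣p∪⁅x⁆∣≡1+∣p∣ x p (x∉p ∘ there))
∣p∪⁅x⁆∣≡1+∣p∣ (fsuc x) (false ∷ p) x∉p = ∣p∪⁅x⁆∣≡1+∣p∣ x p (x∉p ∘ there)

1+∣p-x∣≡∣p∣ : ∀ {n} (x : Fin n) (p : Subset n) → x ∈ p → suc ∣ p - x ∣ ≡ ∣ p ∣
1+∣p-x∣≡∣p∣ fzero    (true ∷ p)  here       = cong (suc ∘ ∣_∣) (p─⊥≡p p)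
1+∣p-x∣≡∣p∣ (fsuc x) (true ∷ p)  (there x∈p) = cong suc (1+∣p-x∣≡∣p∣ x p x∈p)
1+∣p-x∣≡∣p∣ (fsuc x) (false ∷ p) (there x∈p) = 1+∣p-x∣≡∣p∣ x p x∈p

x∈p-y⇒x≢y : ∀ {n} {x y : Fin n} (p : Subset n) → x ∈ p - y → x ≢ y
x∈p-y⇒x≢y {y = fzero}  (_ ∷ p) ()          refl
x∈p-y⇒x≢y {y = fsuc y} (_ ∷ p) (there x∈p) refl = x∈p-y⇒x≢y p x∈p refl

p∪⁅x⁆-x≡p : ∀ {n} (p : Subset n) x → x ∉ p → (p ∪ ⁅ x ⁆) - x ≡ p
p∪⁅x⁆-x≡p p x x∉p = ⊆-antisym to from
  where
  to : (p ∪ ⁅ x ⁆) - x ⊆ p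
  to {z} z∈ with x∈p∪q⁻ p ⁅ x ⁆ (p─q⊆p (p ∪ ⁅ x ⁆) ⁅ x ⁆ z∈)
  ... | inj₁ z∈p = z∈p
  ... | inj₂ z∈x = contradiction (x∈⁅y⁆⇒x≡y x z∈x) (x∈p-y⇒x≢y (p ∪ ⁅ x ⁆) z∈)
  from : p ⊆ (p ∪ ⁅ x ⁆) - x
  from {z} z∈p = x∈p∧x≢y⇒x∈p-y (x∈p∪q⁺ (inj₁ z∈p)) (λ { refl → x∉p z∈p })

¬¬-∀-Fin : ∀ {n q} {Q : Fin n → Set q} → (∀ j → ¬ ¬ Q j) → ¬ ¬ (∀ j → Q j)
¬¬-∀-Fin {zero}  h ¬all = ¬all (λ ())
¬¬-∀-Fin {suc n} {Q = Q} h ¬all =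
  h fzero λ q₀ → ¬¬-∀-Fin {Q = Q ∘ fsuc} (h ∘ fsuc) λ qs →
    ¬all λ { fzero → q₀ ; (fsuc j) → qs j }

module OrderedGroup {c ℓ : Level} (G : LinOrdAbGroup c ℓ) where
  open LinOrdAbGroup G
  open Tropical G using (sumOver)

  +-abelianGroup : AbelianGroup c c
  +-abelianGroup = record
    { Carrier = Carrier ; _≈_ = _≡_ ; _∙_ = _+_ ; ε = 0# ; _⁻¹ = -_
    ; isAbelianGroup = record
      { isGroup = record
        { isMonoid = record
          { isSemigroup = record
            { isMagma = record { isEquivalence = isEquivalence ; ∙-cong = cong₂ _+_ }
            ; assoc = +-assoc }
          ; identity = +-identityˡ , λ a → trans (+-comm a 0#) (+-identityˡ a) }
        ; inverse = -‿inverseˡ , λ a → trans (+-comm a (- a)) (-‿inverseˡ a)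
        ; ⁻¹-cong = cong (λ a → - a) }
      ; comm = +-comm } }

  open AbelianGroupProperties +-abelianGroup using (⁻¹-∙-comm; //-rightDividesʳ)
  open CommutativeSemigroupProperties (AbelianGroup.commutativeSemigroup +-abelianGroup)
    using (interchange; x∙yz≈y∙xz)
    public

  -‿distrib-+ : ∀ a b → - (a + b) ≡ (- a) + (- b)
  -‿distrib-+ a b = sym (⁻¹-∙-comm a b)

  +-mono-≤ : ∀ {a b c d} → a ≤ b → c ≤ d → a + c ≤ b + d
  +-mono-≤ {a} {b} {c} {d} a≤b c≤d = ≤-trans (+-monoˡ-≤ c a≤b)
    (subst₂ _≤_ (+-comm c b) (+-comm d b) (+-monoˡ-≤ b c≤d))

  +-cancelʳ-≤ : ∀ {a b} c → a + c ≤ b + c → a ≤ b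
  +-cancelʳ-≤ {a} {b} c h =
    subst₂ _≤_ (//-rightDividesʳ c a) (//-rightDividesʳ c b) (+-monoˡ-≤ (- c) h)

  +-cancelˡ-≤ : ∀ {a b} c → c + a ≤ c + b → a ≤ b
  +-cancelˡ-≤ {a} {b} c h = +-cancelʳ-≤ c (subst₂ _≤_ (+-comm c a) (+-comm c b) h)

  +-squeeze : ∀ {a b a' b'} → a + b ≤ a' + b' → a' ≤ a → b' ≤ b → (a ≤ a') × (b ≤ b')
  +-squeeze {a} {b} {a'} {b'} sum≤ a'≤a b'≤b =
    +-cancelʳ-≤ b (≤-trans sum≤ (+-mono-≤ (≤-refl a') b'≤b)) ,
    +-cancelˡ-≤ a (≤-trans sum≤ (+-mono-≤ a'≤a (≤-refl b')))

  sumOver-remove : ∀ {n} (f : Fin n → Carrier) x (p : Subset n) → x ∈ p →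
                   sumOver f p ≡ f x + sumOver f (p - x)
  sumOver-remove f fzero (true ∷ p) here =
    cong (λ q → f fzero + sumOver (f ∘ fsuc) q) (sym (p─⊥≡p p))
  sumOver-remove f (fsuc x) (true ∷ p) (there x∈p) = begin
    f fzero + sumOver (f ∘ fsuc) p
      ≡⟨ cong (f fzero +_) (sumOver-remove (f ∘ fsuc) x p x∈p) ⟩
    f fzero + (f (fsuc x) + sumOver (f ∘ fsuc) (p - x))
      ≡⟨ x∙yz≈y∙xz (f fzero) (f (fsuc x)) _ ⟩
    f (fsuc x) + (f fzero + sumOver (f ∘ fsuc) (p - x)) ∎
    where open ≡-Reasoning
  sumOver-remove f (fsuc x) (false ∷ p) (there x∈p) = sumOver-remove (f ∘ fsuc) x p x∈p

module TropicalArithmetic {c ℓ : Level} (G : LinOrdAbGroup c ℓ) where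
  open LinOrdAbGroup G
  open Tropical G
  open OrderedGroup G

  ≤T-refl : ∀ t → t ≤T t
  ≤T-refl (fin a) = fin≤fin (≤-refl a)
  ≤T-refl ∞       = ∞ ≤∞

  ≤T-trans : ∀ {s t u} → s ≤T t → t ≤T u → s ≤T u
  ≤T-trans (fin≤fin s≤t) (fin≤fin t≤u) = fin≤fin (≤-trans s≤t t≤u)
  ≤T-trans _             (_ ≤∞)        = _ ≤∞

  ≤T-total : ∀ s t → (s ≤T t) ⊎ (t ≤T s)
  ≤T-total (fin a) (fin b) = ⊎-map fin≤fin fin≤fin (≤-total a b)
  ≤T-total s       ∞       = inj₁ (s ≤∞)
  ≤T-total ∞       t       = inj₂ (t ≤∞)

  +T-mono : ∀ {s s' t t'} → s ≤T s' → t ≤T t' → s +T t ≤T s' +T t'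
  +T-mono (fin≤fin s≤s') (fin≤fin t≤t') = fin≤fin (+-mono-≤ s≤s' t≤t')
  +T-mono (fin≤fin _)    (_ ≤∞)         = _ ≤∞
  +T-mono (_ ≤∞)         _              = _ ≤∞

  -ᵣ-cancel : ∀ {s t} a → s -ᵣ a ≤T t -ᵣ a → s ≤T t
  -ᵣ-cancel {fin s} {fin t} a (fin≤fin h) = fin≤fin (+-cancelʳ-≤ (- a) h)
  -ᵣ-cancel {s}     {∞}     a _           = s ≤∞
  -ᵣ-cancel {∞}     {fin t} a ()

  -ᵣ-distrib-+T : ∀ s t a b → (s +T t) -ᵣ (a + b) ≡ (s -ᵣ a) +T (t -ᵣ b)
  -ᵣ-distrib-+T (fin s) (fin t) a b = cong fin (begin
    (s + t) + - (a + b)     ≡⟨ cong ((s + t) +_) (-‿distrib-+ a b) ⟩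
    (s + t) + (- a + - b)   ≡⟨ interchange s t (- a) (- b) ⟩
    (s + - a) + (t + - b)   ∎)
    where open ≡-Reasoning
  -ᵣ-distrib-+T (fin s) ∞ a b = refl
  -ᵣ-distrib-+T ∞       t a b = refl

  IsFin-≤T : ∀ {s t} → s ≤T t → IsFin t → IsFin s
  IsFin-≤T (fin≤fin {a} _) _ = isFin a

  IsFin-ᵣ : ∀ {t} a → IsFin t → IsFin (t -ᵣ a)
  IsFin-ᵣ a (isFin t) = isFin (t + - a)

  IsFin-ᵣ⁻ : ∀ {t} a → IsFin (t -ᵣ a) → IsFin t
  IsFin-ᵣ⁻ {fin t} a _ = isFin t

  +T-squeeze : ∀ {p q p' q'} → p +T q ≤T p' +T q' → p' ≤T p → q' ≤T q →
               IsFin p' → IsFin q' → (p ≤T p') × (q ≤T q')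
  +T-squeeze {fin a} {fin b} (fin≤fin sum≤) (fin≤fin p'≤p) (fin≤fin q'≤q) _ _ =
    map fin≤fin fin≤fin (+-squeeze sum≤ p'≤p q'≤q)
  +T-squeeze {fin a} {∞} () _ _ (isFin _) (isFin _)
  +T-squeeze {∞}         () _ _ (isFin _) (isFin _)

module Rank {c ℓ : Level} (G : LinOrdAbGroup c ℓ) where
  open Tropical G

  rank-grows : ∀ {n} (M : Matroid n) {F B B' : Subset n} {e r r'} →
    e ∉ F → ∣ B ∩ F ∣ ≡ r → M B' → B ∩ F ⊆ B' → e ∈ B' →
    IsRank M (F ∪ ⁅ e ⁆) r' → r < r'
  rank-grows M {F} {B} {B'} {e} {r} e∉F ∣B∩F∣≡r MB' B∩F⊆B' e∈B' (_ , bound) = begin-strict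
    r                          ≡⟨ sym ∣B∩F∣≡r ⟩
    ∣ B ∩ F ∣                  <⟨ ℕₚ.n<1+n _ ⟩
    suc ∣ B ∩ F ∣              ≡⟨ sym (∣p∪⁅x⁆∣≡1+∣p∣ e (B ∩ F) (e∉F ∘ proj₂ ∘ x∈p∩q⁻ B F)) ⟩
    ∣ (B ∩ F) ∪ ⁅ e ⁆ ∣        ≤⟨ p⊆q⇒∣p∣≤∣q∣ grown⊆ ⟩
    ∣ B' ∩ (F ∪ ⁅ e ⁆) ∣       ≤⟨ bound B' MB' ⟩
    _                          ∎
    where
    open ℕₚ.≤-Reasoning
    grown⊆ : (B ∩ F) ∪ ⁅ e ⁆ ⊆ B' ∩ (F ∪ ⁅ e ⁆)
    grown⊆ {z} z∈ with x∈p∪q⁻ (B ∩ F) ⁅ e ⁆ z∈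
    ... | inj₁ z∈B∩F = x∈p∩q⁺ (B∩F⊆B' z∈B∩F , x∈p∪q⁺ (inj₁ (proj₂ (x∈p∩q⁻ B F z∈B∩F))))
    ... | inj₂ z∈⁅e⁆ with refl ← x∈⁅y⁆⇒x≡y e z∈⁅e⁆ = x∈p∩q⁺ (e∈B' , x∈p∪q⁺ (inj₂ z∈⁅e⁆))

module Exchange {c ℓ : Level} (G : LinOrdAbGroup c ℓ) {n d : ℕ}
  (V : Subset n → Tropical.T G) (x : Fin n → LinOrdAbGroup.Carrier G)
  (y : Fin n → Tropical.T G) where
  open LinOrdAbGroup G using (_+_; -_)
  open Tropical G
  open OrderedGroup G using (sumOver-remove)
  open TropicalArithmetic G

  P : Fin n → T
  P j = y j -ᵣ x j

  w : Subset n → T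
  w S = V S -ᵣ sumOver x S

  ∉relsupp⇒minimal : ∀ {e} → ¬ InRelsupp x y e → ∀ j → ¬ ¬ (P e ≤T P j)
  ∉relsupp⇒minimal {e} e∉ j ¬Pe≤Pj with ≤T-total (P e) (P j)
  ... | inj₁ Pe≤Pj = ¬Pe≤Pj Pe≤Pj
  ... | inj₂ Pj≤Pe = e∉ (j , Pj≤Pe , ¬Pe≤Pj)

  ∉relsupp-downward : ∀ {e k} → ¬ InRelsupp x y e → P k ≤T P e → ¬ InRelsupp x y k
  ∉relsupp-downward e∉ Pk≤Pe (j , Pj≤Pk , ¬Pk≤Pj) =
    e∉ (j , ≤T-trans Pj≤Pk Pk≤Pe , λ Pe≤Pj → ¬Pk≤Pj (≤T-trans Pk≤Pe Pe≤Pj))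

  circuit-term : ∀ C j → j ∈ C → (y j +T V (C - j)) -ᵣ sumOver x C ≡ P j +T w (C - j)
  circuit-term C j j∈C = begin
    (y j +T V (C - j)) -ᵣ sumOver x C
      ≡⟨ cong ((y j +T V (C - j)) -ᵣ_) (sumOver-remove x j C j∈C) ⟩
    (y j +T V (C - j)) -ᵣ (x j + sumOver x (C - j))
      ≡⟨ -ᵣ-distrib-+T (y j) (V (C - j)) (x j) (sumOver x (C - j)) ⟩
    P j +T w (C - j) ∎
    where open ≡-Reasoning

  module Circuit {B : Subset n} {e : Fin n} (B-basis : InitialBasis d V x B)
    (e∉B : e ∉ B) (e-min : ∀ j → P e ≤T P j) where

    C : Subset n
    C = B ∪ ⁅ e ⁆

    e∈C : e ∈ C
    e∈C = x∈p∪q⁺ (inj₂ (x∈⁅x⁆ e))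

    ∣C∣≡1+d : ∣ C ∣ ≡ suc d
    ∣C∣≡1+d = trans (∣p∪⁅x⁆∣≡1+∣p∣ e B e∉B) (cong suc (proj₁ B-basis))

    ∣C-j∣≡d : ∀ j → j ∈ C → ∣ C - j ∣ ≡ d
    ∣C-j∣≡d j j∈C = ℕₚ.suc-injective (trans (1+∣p-x∣≡∣p∣ j C j∈C) ∣C∣≡1+d)

    wB≤wC-j : ∀ j → j ∈ C → w B ≤T w (C - j)
    wB≤wC-j j j∈C = proj₂ (proj₂ B-basis) (C - j) (∣C-j∣≡d j j∈C)

    wB-fin : IsFin (w B)
    wB-fin = IsFin-ᵣ (sumOver x B) (proj₁ (proj₂ B-basis))

    term-e : (y e +T V (C - e)) -ᵣ sumOver x C ≡ P e +T w B
    term-e = trans (circuit-term C e e∈C) (cong (λ S → P e +T w S) (p∪⁅x⁆-x≡p B e e∉B))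

    -- both parts of the split are minimal at e, so the term at e is minimal
    e-minimises : ∀ j → j ∈ C → y e +T V (C - e) ≤T y j +T V (C - j)
    e-minimises j j∈C = -ᵣ-cancel (sumOver x C)
      (subst₂ _≤T_ (sym term-e) (sym (circuit-term C j j∈C))
        (+T-mono (e-min j) (wB≤wC-j j j∈C)))

    -- A second minimiser k forces both parts of its split to be minimal
    -- too; in particular C - k is again a basis of V^x.
    second-minimiser : IsFin (P e) → ∀ k → k ∈ C →
      y k +T V (C - k) ≤T y e +T V (C - e) →
      (P k ≤T P e) × InitialBasis d V x (C - k)
    second-minimiser Pe-fin k k∈C k-minimises =
      Pk≤Pe , ∣C-j∣≡d k k∈C , IsFin-ᵣ⁻ (sumOver x (C - k)) (IsFin-≤T wCk≤wB wB-fin) ,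
      λ B' ∣B'∣≡d → ≤T-trans wCk≤wB (proj₂ (proj₂ B-basis) B' ∣B'∣≡d)
      where
      squeezed : (P k ≤T P e) × (w (C - k) ≤T w B)
      squeezed = +T-squeeze
        (subst₂ _≤T_ (circuit-term C k k∈C) term-e
          (+T-mono k-minimises (≤T-refl (fin (- sumOver x C)))))
        (e-min k) (wB≤wC-j k k∈C) Pe-fin wB-fin
      Pk≤Pe : P k ≤T P e
      Pk≤Pe = proj₁ squeezed
      wCk≤wB : w (C - k) ≤T w B
      wCk≤wB = proj₂ squeezed

    exchange : InL d V y →
      Σ (Fin n) λ k → (k ∈ B) × (P k ≤T P e) × InitialBasis d V x (C - k)
    exchange ((j₀ , y-fin) , plücker) with plücker C ∣C∣≡1+d e e∈C e-minimises
    ... | k , k∈C , k≢e , k-minimises = k , k∈B , second-minimiser Pe-fin k k∈C k-minimises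
      where
      Pe-fin : IsFin (P e)
      Pe-fin = IsFin-≤T (e-min j₀) (IsFin-ᵣ (x j₀) y-fin)
      k∈B : k ∈ B
      k∈B with x∈p∪q⁻ B ⁅ e ⁆ k∈C
      ... | inj₁ k∈B   = k∈B
      ... | inj₂ k∈⁅e⁆ = contradiction (x∈⁅y⁆⇒x≡y e k∈⁅e⁆) k≢e

proposition4p4 : ∀ {c ℓ : Level} (G : LinOrdAbGroup c ℓ) →
    let open Tropical G in
    (n d : ℕ) (V : Subset n → T) → IsValuatedMatroid n d V →
    (M : Matroid n) → InMV d V M →
    (x : Fin n → LinOrdAbGroup.Carrier G) → InRelint d V M x →
    (y : Fin n → T) → InL d V y →
    (F : Subset n) → (∀ j → (j ∈ F → InRelsupp x y j) × (InRelsupp x y j → j ∈ F)) →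
    IsFlat M F
proposition4p4 G n d V _ M _ x relint y y∈L F F≡relsupp e e∉F r r'
  ((B , MB , ∣B∩F∣≡r) , _) rank' =
  decidable-stable (r <? r') (¬¬-map grows (¬¬-∀-Fin (∉relsupp⇒minimal e∉relsupp)))
  where
  open Tropical G
  open Rank G
  open Exchange G V x y
  e∉relsupp : ¬ InRelsupp x y e
  e∉relsupp = e∉F ∘ proj₂ (F≡relsupp e)
  grows : (∀ j → P e ≤T P j) → r < r'
  grows e-min with e ∈? B
  ... | yes e∈B = rank-grows M e∉F ∣B∩F∣≡r MB (proj₁ ∘ x∈p∩q⁻ B F) e∈B rank'
  ... | no e∉B with Circuit.exchange (proj₂ (relint B) MB) e∉B e-min y∈L
  ...   | k , k∈B , Pk≤Pe , basis =
    rank-grows M e∉F ∣B∩F∣≡r (proj₁ (relint _) basis) B∩F⊆B∪e-k e∈B∪e-k rank'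
    where
    -- k is as small as e in P, hence outside relsupp = F
    k∉F : k ∉ F
    k∉F = ∉relsupp-downward e∉relsupp Pk≤Pe ∘ proj₁ (F≡relsupp k)
    B∩F⊆B∪e-k : B ∩ F ⊆ (B ∪ ⁅ e ⁆) - k
    B∩F⊆B∪e-k {z} z∈ with x∈p∩q⁻ B F z∈
    ... | z∈B , z∈F = x∈p∧x≢y⇒x∈p-y (x∈p∪q⁺ (inj₁ z∈B)) λ { refl → k∉F z∈F }
    e∈B∪e-k : e ∈ (B ∪ ⁅ e ⁆) - k
    e∈B∪e-k = x∈p∧x≢y⇒x∈p-y (x∈p∪q⁺ (inj₂ (x∈⁅x⁆ e))) λ { refl → e∉B k∈B }
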